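{- In $\mathrm{Ord}$ the following hold: (a) for all $\alpha,\beta\in\mathrm{Ord}$, $\beta\le\alpha$ and $\alpha<\beta$ are incompatible; (b) the map $n\mapsto\underline n$, $\mathbb N\to\mathrm{Ord}$, is injective, and $m<n$ if and only if $\underline m<\underline n$; (c) for all $\alpha\in\mathrm{Ord}$ and all $n>m$ in $\mathbb N$, it is impossible that $\mathrm{suc}^{(n)}(\alpha)=_{\mathrm{Ord}}\mathrm{suc}^{(m)}(\alpha)$. In particular $\mathrm{Ord}$ is not reduced to a point.
   Context: The setting is constructive. Let $\mathfrak F$ be a set of index sets containing $\mathbb N$ and every $\mathbb N_k=\{n\in\mathbb N:n<k\}$, closed (up to isomorphism) under finitely enumerated subsets, sets of finitely enumerated subsets, and disjoint unions indexed by elements of $\mathfrak F$. The set $\mathrm{ord}=\mathrm{ord}_{\mathfrak F}$ is defined inductively: a distinguished element $\underline 0$, and for every $I\in\mathfrak F$ and family $(\alpha_i)_{i\in I}$ in $\mathrm{ord}$ an element $\mathrm S(\alpha_i)_{i\in I}$. For $\alpha=\mathrm S(\alpha_i)_{i\in I}$, $\mathrm{In}_\alpha=I$; by convention $\mathrm{In}_{\underline0}=\emptyset$. For a finite list $F\subseteq_f\mathrm{In}_\alpha$, $\alpha_F$ is the list of the $\alpha_i$, $i\in F$. By simultaneous induction ($m\ge1$): $\alpha\le\beta^1,\dots,\beta^m$ means $\alpha_i<\beta^1,\dots,\beta^m$ for all $i\in\mathrm{In}_\alpha$; $\alpha<\beta^1,\dots,\beta^m$ means there exist $F_k\subseteq_f\mathrm{In}_{\beta^k}$,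 not all empty, with $\alpha\le\beta^1_{F_1},\dots,\beta^m_{F_m}$; $m=1$ gives binary $\le,<$. $\alpha=_{\mathrm{Ord}}\beta$ means $\alpha\le\beta$ and $\beta\le\alpha$; this is an equivalence relation, $\mathrm{Ord}$ is the quotient, and $\le,<,\mathrm{suc}$ descend to it. $\mathrm{suc}(\alpha)=\mathrm S(\beta_i)_{i\in\mathbb N_1}$ with $\beta_0=\alpha$; $\mathrm{suc}^{(n)}$ is its $n$-fold iterate; $\underline{n+1}=\mathrm{suc}(\underline n)$. -}

module Defs where

open import Data.Nat using (ℕ; zero; suc)
open import Data.Fin using (Fin)
open import Data.Product using (Σ; _×_; _,_)
open import Data.Empty using (⊥)
open import Data.Sum using (_⊎_)
open import Data.Unit using (⊤)
open import Data.List using (List; []; _∷_; [_]; map; concat; _++_)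
open import Data.List.Relation.Unary.All using (All; []; _∷_)
open import Relation.Binary.PropositionalEquality using (_≡_)
open import Relation.Nullary using (¬_)
open import Function.Bundles using (_↔_)

Image : {X : Set} {n : ℕ} → (Fin n → X) → Set
Image {X} {n} e = Σ X (λ x → Σ (Fin n) (λ k → e k ≡ x))

-- The collection 𝔉 of index sets, as a universe of codes (U, El),
-- containing ℕ and every ℕ_k, closed up to isomorphism under
-- finitely enumerated subsets, sets of finitely enumerated subsets
-- (represented by their enumerations), and 𝔉-indexed disjoint unions.
record IndexSets : Set₁ where
  field
    U      : Set
    El     : U → Set
    `ℕ     : U
    `ℕ-iso : El `ℕ ↔ ℕ
    `Fin     : ℕ → U
    `Fin-iso : (k : ℕ) → El (`Fin k) ↔ Fin k
    `sub     : (a : U) (n : ℕ) (e : Fin n → El a) → U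
    `sub-iso : (a : U) (n : ℕ) (e : Fin n → El a) → El (`sub a n e) ↔ Image e
    `Pfin     : U → U
    `Pfin-iso : (a : U) → El (`Pfin a) ↔ Σ ℕ (λ n → Fin n → El a)
    `Σ     : (a : U) → (El a → U) → U
    `Σ-iso : (a : U) (b : El a → U) → El (`Σ a b) ↔ Σ (El a) (λ i → El (b i))

module OrdDefs (𝔉 : IndexSets) where
  open IndexSets 𝔉

  data ord : Set where
    0̲ : ord
    S  : (a : U) → (El a → ord) → ord

  In : ord → Set
  In 0̲      = ⊥
  In (S a f) = El a

  comp : (β : ord) → In β → ord
  comp 0̲ ()
  comp (S a f) i = f i

  Sel : List ord → Set
  Sel βs = All (λ β → List (In β)) βs

  select : (βs : List ord) → Sel βs → List ord
  select [] [] = []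
  select (β ∷ βs) (F ∷ Fs) = map (comp β) F ++ select βs Fs

  NotAllEmpty : {βs : List ord} → Sel βs → Set
  NotAllEmpty [] = ⊥
  NotAllEmpty (F ∷ Fs) = (¬ (F ≡ [])) ⊎ NotAllEmpty Fs

  mutual
    _≤*_ : ord → List ord → Set
    0̲     ≤* βs = ⊤
    S a f ≤* βs = (i : El a) → f i <* βs

    _<*_ : ord → List ord → Set
    α <* βs = Σ (Sel βs) (λ Fs → NotAllEmpty Fs × (α ≤* select βs Fs))

  _≤_ : ord → ord → Set
  α ≤ β = α ≤* [ β ]

  _<_ : ord → ord → Set
  α < β = α <* [ β ]

  _=Ord_ : ord → ord → Set
  α =Ord β = (α ≤ β) × (β ≤ α)

  sucᵒ : ord → ord
  sucᵒ α = S (`Fin 1) (λ _ → α)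

  sucᵒ^ : ℕ → ord → ord
  sucᵒ^ zero α = α
  sucᵒ^ (suc n) α = sucᵒ (sucᵒ^ n α)

  under : ℕ → ord
  under n = sucᵒ^ n 0̲

{-# OPTIONS --safe #-}
-- Everything rests on irreflexivity of <. Write D ⊏ xs when D is a nonempty list of children
-- of members of xs. This relation is well founded on finite lists: each [ α ] is accessible by
-- induction on α, and accessibility is preserved by concatenation. If every member of a nonempty
-- list xs were < xs, the witnesses would merge into one D ⊏ xs with every x ≤ D, and then, by
-- transitivity of the many-argument relations, every d in D would be < D: an infinite descent.
-- Since α ≤ β gives α < suc β, iterated successors are strictly increasing, hence distinct.
module Submission where

open import Defs
open import Data.Nat using (ℕ)
open import Data.Product using (Σ; _×_)
open import Relation.Nullary using (¬_)
open import Relation.Binary.PropositionalEquality using (_≡_)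
open import Function.Bundles using (_⇔_)
import Data.Nat as N

open import Data.Nat using (_≤′_; ≤′-refl; ≤′-step)
open import Data.Nat.Properties using (≤⇒≤′; ≮⇒≥; <-cmp; _<?_)
import Data.Fin as Fin
open import Data.Product using (∃-syntax; _,_; proj₁)
open import Data.Sum using (inj₁; inj₂)
open import Data.Empty using (⊥; ⊥-elim)
open import Data.Unit using (⊤; tt)
open import Data.List using (List; []; _∷_; [_]; map; _++_)
open import Data.List.Properties using (++-identityʳ)
open import Data.List.Relation.Unary.All as All using (All; []; _∷_)
import Data.List.Relation.Unary.All.Properties as AllP
open import Data.List.Relation.Unary.Any using (Any; here; there)
import Data.List.Relation.Unary.Any.Properties as AnyP
open import Data.List.Relation.Binary.Subset.Propositional using (_⊆_)
open import Data.List.Relation.Binary.Subset.Propositional.Properties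
  using (⊆-refl; ⊆-trans; xs⊆x∷xs; xs⊆xs++ys; xs⊆ys++xs; ++⁺ʳ; ∷⁺ʳ; ∈-∷⁺ʳ; Any-resp-⊆)
open import Induction.WellFounded using (Acc; acc; WellFounded)
open import Relation.Binary.PropositionalEquality using (refl; sym; subst)
open import Relation.Binary.Definitions using (tri<; tri≈; tri>)
open import Relation.Nullary using (yes; no)
open import Function.Bundles using (Inverse; mk⇔)

module OrdProperties (𝔉 : IndexSets) where
  open IndexSets 𝔉
  open OrdDefs 𝔉

  NonEmpty : List ord → Set
  NonEmpty []      = ⊥
  NonEmpty (_ ∷ _) = ⊤

  NonEmpty-++ : ∀ xs {ys} → NonEmpty xs → NonEmpty (xs ++ ys)
  NonEmpty-++ (_ ∷ _) _ = tt

  ChildOf : ord → ord → Set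
  ChildOf c β = Σ (In β) (λ i → comp β i ≡ c)

  ChildrenOf : List ord → List ord → Set
  ChildrenOf βs cs = All (λ c → Any (ChildOf c) βs) cs

  select-children : ∀ βs (Fs : Sel βs) → ChildrenOf βs (select βs Fs)
  select-children []       []       = []
  select-children (β ∷ βs) (F ∷ Fs) =
    AllP.++⁺ (AllP.map⁺ (All.universal (λ i → here (i , refl)) F))
             (All.map there (select-children βs Fs))

  select-nonEmpty : ∀ βs (Fs : Sel βs) → NotAllEmpty Fs → NonEmpty (select βs Fs)
  select-nonEmpty (β ∷ βs) ([]      ∷ Fs) (inj₁ F≢[]) = ⊥-elim (F≢[] refl)
  select-nonEmpty (β ∷ βs) ([]      ∷ Fs) (inj₂ ne)   = select-nonEmpty βs Fs ne
  select-nonEmpty (β ∷ βs) ((_ ∷ _) ∷ Fs) _           = tt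

  addChild : ∀ {c βs} → Any (ChildOf c) βs → Sel βs → Sel βs
  addChild (here (i , _)) (F ∷ Fs) = (i ∷ F) ∷ Fs
  addChild (there p)      (F ∷ Fs) = F ∷ addChild p Fs

  addChild-notAllEmpty : ∀ {c βs} (p : Any (ChildOf c) βs) (Fs : Sel βs) →
                         NotAllEmpty (addChild p Fs)
  addChild-notAllEmpty (here _)  (F ∷ Fs) = inj₁ (λ ())
  addChild-notAllEmpty (there p) (F ∷ Fs) = inj₂ (addChild-notAllEmpty p Fs)

  select-addChild : ∀ {c βs} (p : Any (ChildOf c) βs) (Fs : Sel βs) →
                    c ∷ select βs Fs ⊆ select βs (addChild p Fs)
  select-addChild (here (i , refl)) (F ∷ Fs) = ⊆-refl
  select-addChild {βs = γ ∷ βs} (there p) (F ∷ Fs) =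
    ∈-∷⁺ʳ (xs⊆ys++xs _ (map (comp γ) F) (select-addChild p Fs (here refl)))
          (++⁺ʳ (map (comp γ) F) (⊆-trans (xs⊆x∷xs _ _) (select-addChild p Fs)))

  selection-covering : ∀ βs {cs} → ChildrenOf βs cs →
    Σ (Sel βs) (λ Fs → cs ⊆ select βs Fs × (NonEmpty cs → NotAllEmpty Fs))
  selection-covering βs []       = All.universal (λ _ → []) βs , (λ ()) , (λ ())
  selection-covering βs (p ∷ ps) with selection-covering βs ps
  ... | Fs , cs⊆Fs , _ =
    addChild p Fs , ⊆-trans (∷⁺ʳ _ cs⊆Fs) (select-addChild p Fs) , λ _ → addChild-notAllEmpty p Fs

  _<ᶜ_ : ord → List ord → Set
  α <ᶜ βs = ∃[ cs ] NonEmpty cs × ChildrenOf βs cs × α ≤* cs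

  <*⇒<ᶜ : ∀ {α βs} → α <* βs → α <ᶜ βs
  <*⇒<ᶜ {βs = βs} (Fs , ne , le) =
    select βs Fs , select-nonEmpty βs Fs ne , select-children βs Fs , le

  <ᶜ-mono-⊆ : ∀ {α βs γs} → βs ⊆ γs → α <ᶜ βs → α <ᶜ γs
  <ᶜ-mono-⊆ sub (cs , ne , ch , le) = cs , ne , All.map (Any-resp-⊆ sub) ch , le

  mutual
    ≤*-mono-⊆ : ∀ α {βs γs} → βs ⊆ γs → α ≤* βs → α ≤* γs
    ≤*-mono-⊆ 0̲       _   _  = tt
    ≤*-mono-⊆ (S a f) sub le = λ i → <ᶜ⇒<* (f i) (<ᶜ-mono-⊆ sub (<*⇒<ᶜ (le i)))

    <ᶜ⇒<* : ∀ α {βs} → α <ᶜ βs → α <* βs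
    <ᶜ⇒<* α {βs} (cs , ne , ch , le) with selection-covering βs ch
    ... | Fs , cs⊆Fs , ne⇒ = Fs , ne⇒ ne , ≤*-mono-⊆ α cs⊆Fs le

  _≤*ᴸ_ : List ord → List ord → Set
  xs ≤*ᴸ ys = All (_≤* ys) xs

  _<*ᴸ_ : List ord → List ord → Set
  xs <*ᴸ ys = All (_<* ys) xs

  ≤*ᴸ-children : ∀ {βs γs cs} → βs ≤*ᴸ γs → ChildrenOf βs cs → cs <*ᴸ γs
  ≤*ᴸ-children βs≤γs = All.map (child βs≤γs)
    where
    ≤*-child : ∀ β {γs} (i : In β) → β ≤* γs → comp β i <* γs
    ≤*-child (S a f) i le = le i

    child : ∀ {βs γs c} → βs ≤*ᴸ γs → Any (ChildOf c) βs → c <* γs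
    child (le ∷ _)  (here (i , refl)) = ≤*-child _ i le
    child (_ ∷ les) (there p)         = child les p

  <*ᴸ-common-children : ∀ {cs γs} → cs <*ᴸ γs →
    ∃[ D ] ChildrenOf γs D × cs ≤*ᴸ D × (NonEmpty cs → NonEmpty D)
  <*ᴸ-common-children [] = [] , [] , [] , λ ()
  <*ᴸ-common-children {c ∷ _} (lt ∷ lts) with <*⇒<ᶜ lt | <*ᴸ-common-children lts
  ... | ds , ne , ch , le | D , chD , cs≤D , _ =
    ds ++ D , AllP.++⁺ ch chD ,
    ≤*-mono-⊆ c (xs⊆xs++ys ds D) le ∷ All.map (λ {x} → ≤*-mono-⊆ x (xs⊆ys++xs D ds)) cs≤D ,
    λ _ → NonEmpty-++ ds ne

  mutual
    ≤*-trans : ∀ α {βs γs} → α ≤* βs → βs ≤*ᴸ γs → α ≤* γs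
    ≤*-trans 0̲       _  _     = tt
    ≤*-trans (S a f) le βs≤γs = λ i → <*-trans (f i) (le i) βs≤γs

    <*-trans : ∀ α {βs γs} → α <* βs → βs ≤*ᴸ γs → α <* γs
    <*-trans α lt βs≤γs with <*⇒<ᶜ lt
    ... | cs , ne , ch , le with <*ᴸ-common-children (≤*ᴸ-children βs≤γs ch)
    ... | D , chD , cs≤D , ne⇒ = <ᶜ⇒<* α (D , ne⇒ ne , chD , ≤*-trans α le cs≤D)

  _⊏_ : List ord → List ord → Set
  D ⊏ xs = NonEmpty D × ChildrenOf xs D

  ⊏-acc-⊆ : ∀ {xs ys} → ys ⊆ xs → Acc _⊏_ xs → Acc _⊏_ ys
  ⊏-acc-⊆ sub (acc rs) = acc λ (ne , ch) → rs (ne , All.map (Any-resp-⊆ sub) ch)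

  split-children : ∀ ys {zs D} → ChildrenOf (ys ++ zs) D →
    ∃[ D₁ ] ∃[ D₂ ] D ⊆ D₁ ++ D₂ × ChildrenOf ys D₁ × ChildrenOf zs D₂
  split-children ys []       = [] , [] , (λ ()) , [] , []
  split-children ys (p ∷ ps) with split-children ys ps | AnyP.++⁻ ys p
  ... | D₁ , D₂ , sub , ch₁ , ch₂ | inj₁ q = _ ∷ D₁ , D₂ , ∷⁺ʳ _ sub , q ∷ ch₁ , ch₂
  ... | D₁ , D₂ , sub , ch₁ , ch₂ | inj₂ q =
    D₁ , _ ∷ D₂ ,
    ∈-∷⁺ʳ (xs⊆ys++xs _ D₁ (here refl)) (⊆-trans sub (++⁺ʳ D₁ (xs⊆x∷xs D₂ _))) ,
    ch₁ , q ∷ ch₂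

  acc-[] : Acc _⊏_ []
  acc-[] = acc λ { (() , []) ; (_ , () ∷ _) }

  acc-++ : ∀ {ys zs} → Acc _⊏_ ys → Acc _⊏_ zs → Acc _⊏_ (ys ++ zs)
  acc-++ {ys} {zs} (acc rs₁) (acc rs₂) = acc λ (_ , ch) →
    let (D₁ , D₂ , sub , ch₁ , ch₂) = split-children ys ch
    in ⊏-acc-⊆ sub (acc-parts D₁ D₂ ch₁ ch₂)
    where
    acc-parts : ∀ D₁ D₂ → ChildrenOf ys D₁ → ChildrenOf zs D₂ → Acc _⊏_ (D₁ ++ D₂)
    acc-parts []      []      _   _   = acc-[]
    acc-parts []      (_ ∷ _) _   ch₂ = rs₂ (tt , ch₂)
    acc-parts (_ ∷ _) []      ch₁ _   = subst (Acc _⊏_) (sym (++-identityʳ _)) (rs₁ (tt , ch₁))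
    acc-parts (_ ∷ _) (_ ∷ _) ch₁ ch₂ = acc-++ (rs₁ (tt , ch₁)) (rs₂ (tt , ch₂))

  acc-All : ∀ {xs} → All (λ x → Acc _⊏_ [ x ]) xs → Acc _⊏_ xs
  acc-All []       = acc-[]
  acc-All (a ∷ as) = acc-++ a (acc-All as)

  mutual
    acc-[_] : ∀ α → Acc _⊏_ [ α ]
    acc-[ α ] = acc λ (_ , ch) → acc-All (All.map (acc-child α) ch)

    acc-child : ∀ α {c} → Any (ChildOf c) [ α ] → Acc _⊏_ [ c ]
    acc-child (S a f) (here (i , refl)) = acc-[ f i ]
    acc-child 0̲       (here (() , _))

  ⊏-wellFounded : WellFounded _⊏_
  ⊏-wellFounded xs = acc-All (All.universal acc-[_] xs)

  <*ᴸ-descend : ∀ {xs} → NonEmpty xs → xs <*ᴸ xs → ∃[ D ] D ⊏ xs × D <*ᴸ D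
  <*ᴸ-descend ne lts with <*ᴸ-common-children lts
  ... | D , ch , xs≤D , ne⇒ = D , (ne⇒ ne , ch) , ≤*ᴸ-children xs≤D ch

  <*ᴸ-irrefl : ∀ {xs} → NonEmpty xs → ¬ (xs <*ᴸ xs)
  <*ᴸ-irrefl {xs} = go (⊏-wellFounded xs)
    where
    go : ∀ {xs} → Acc _⊏_ xs → NonEmpty xs → ¬ (xs <*ᴸ xs)
    go (acc rs) ne lts with <*ᴸ-descend ne lts
    ... | D , D⊏xs , D<D = go (rs D⊏xs) (proj₁ D⊏xs) D<D

  <-irrefl : ∀ α → ¬ (α < α)
  <-irrefl α α<α = <*ᴸ-irrefl tt (α<α ∷ [])

  ≤⇒≯ : ∀ {α β} → β ≤ α → ¬ (α < β)
  ≤⇒≯ {α} β≤α α<β = <-irrefl α (<*-trans α α<β (β≤α ∷ []))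

  ≤-refl : ∀ α → α ≤ α
  ≤-refl 0̲       = tt
  ≤-refl (S a f) = λ i → ((i ∷ []) ∷ []) , inj₁ (λ ()) , ≤-refl (f i)

  ≤-parent : ∀ {c} β (i : In β) → comp β i ≡ c → c ≤ β
  ≤-parent {0̲}     _ _ _  = tt
  ≤-parent {S b g} β i eq = λ j →
    ((i ∷ []) ∷ []) , inj₁ (λ ()) , subst (λ c → g j ≤* [ c ]) (sym eq) (≤-parent {g j} (S b g) j refl)

  index₀ : El (`Fin 1)
  index₀ = Inverse.from (`Fin-iso 1) Fin.zero

  ≤⇒<sucᵒ : ∀ {α β} → α ≤ β → α < sucᵒ β
  ≤⇒<sucᵒ α≤β = ((index₀ ∷ []) ∷ []) , inj₁ (λ ()) , α≤β

  ≤⇒≤sucᵒ : ∀ {α β} → α ≤ β → α ≤ sucᵒ β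
  ≤⇒≤sucᵒ {α} {β} α≤β = ≤*-trans α α≤β (≤-parent (sucᵒ β) index₀ refl ∷ [])

  sucᵒ^-mono-≤ : ∀ α {m n} → m N.≤ n → sucᵒ^ m α ≤ sucᵒ^ n α
  sucᵒ^-mono-≤ α {m} m≤n = go (≤⇒≤′ m≤n)
    where
    go : ∀ {n} → m ≤′ n → sucᵒ^ m α ≤ sucᵒ^ n α
    go ≤′-refl       = ≤-refl _
    go (≤′-step m≤n) = ≤⇒≤sucᵒ (go m≤n)

  sucᵒ^-mono-< : ∀ α {m n} → m N.< n → sucᵒ^ m α < sucᵒ^ n α
  sucᵒ^-mono-< α (N.s≤s m≤n) = ≤⇒<sucᵒ (sucᵒ^-mono-≤ α m≤n)

  sucᵒ^-distinct : ∀ α m n → m N.< n → ¬ (sucᵒ^ n α =Ord sucᵒ^ m α)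
  sucᵒ^-distinct α m n m<n (n≤m , _) = ≤⇒≯ n≤m (sucᵒ^-mono-< α m<n)

  under-injective : ∀ m n → under m =Ord under n → m ≡ n
  under-injective m n (m≤n , n≤m) with <-cmp m n
  ... | tri< m<n _ _ = ⊥-elim (sucᵒ^-distinct 0̲ m n m<n (n≤m , m≤n))
  ... | tri≈ _ m≡n _ = m≡n
  ... | tri> _ _ n<m = ⊥-elim (sucᵒ^-distinct 0̲ n m n<m (m≤n , n≤m))

  under-cancel-< : ∀ {m n} → under m < under n → m N.< n
  under-cancel-< {m} {n} lt with m <? n
  ... | yes m<n = m<n
  ... | no  m≮n = ⊥-elim (≤⇒≯ (sucᵒ^-mono-≤ 0̲ (≮⇒≥ m≮n)) lt)

theorem4p9 : (𝔉 : IndexSets) → let open OrdDefs 𝔉 in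
    ((α β : ord) → ¬ ((β ≤ α) × (α < β)))
    × ((m n : ℕ) → under m =Ord under n → m ≡ n)
    × ((m n : ℕ) → (m N.< n) ⇔ (under m < under n))
    × ((α : ord) (m n : ℕ) → m N.< n → ¬ (sucᵒ^ n α =Ord sucᵒ^ m α))
    × Σ ord (λ α → Σ ord (λ β → ¬ (α =Ord β)))
theorem4p9 𝔉 =
    (λ α β (β≤α , α<β) → ≤⇒≯ β≤α α<β)
  , under-injective
  , (λ m n → mk⇔ (sucᵒ^-mono-< 0̲) under-cancel-<)
  , sucᵒ^-distinct
  , sucᵒ 0̲ , 0̲ , sucᵒ^-distinct 0̲ 0 1 (N.s≤s N.z≤n)
  where
  open OrdDefs 𝔉
  open OrdProperties 𝔉
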